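{- Let $E=\{e_0,\dots,e_n\}\subset\mathbb R^n$ be the vertex set of a simplex with $e_0+\dots+e_n=0$, and let $X\subset\mathbb R^n\setminus\{0\}$ be a finite set with $E\subseteq X$, no element a positive multiple of another, such that no $n+1$ points of $X$ are in conical position. Let $p,q\in X$ with $|S_p\cap S_q|=1$, $|S_p|=2$ and $|S_q|=n$, and let $r\in X$ with $S_r\ne S_p$, $S_r\ne S_q$ and $|S_r|\ge 2$. Then either $S_r\subseteq S_q\setminus S_p$ or $S_r=(S_p\setminus S_q)\cup(S_q\setminus S_p)$.
   Context: For $p\in\mathbb R^n$, the support $S_p$ is the minimal subset of $E$ whose positive hull contains $p$. A set of points is in conical position if $0$ is not in its convex hull and none of its points lies in the positive hull of the others. -}

module Defs where

open import Level using (0ℓ)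
open import Data.Nat using (ℕ; zero; suc)
open import Data.Fin using (Fin; zero; suc)
open import Data.Fin.Subset using (Subset; _∈_; _∉_; _⊂_)
open import Data.Product using (Σ; ∃; _×_; _,_)
open import Data.Sum using (_⊎_)
open import Data.Empty using (⊥)
open import Relation.Nullary using (¬_)
open import Relation.Binary.PropositionalEquality using (_≡_; _≢_)

-- The real numbers, given axiomatically as a Dedekind-complete ordered field
-- (unique up to isomorphism, so quantifying over all of them = speaking about ℝ).
record RealField : Set₁ where
  infixl 6 _+_
  infixl 7 _*_
  infix 4 _<_ _≤_
  field
    ℝ    : Set
    0r 1r : ℝ
    _+_ _*_ : ℝ → ℝ → ℝ
    -_   : ℝ → ℝ
    _<_  : ℝ → ℝ → Set
    +-assoc : ∀ x y z → (x + y) + z ≡ x + (y + z)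
    +-comm  : ∀ x y → x + y ≡ y + x
    +-idʳ   : ∀ x → x + 0r ≡ x
    +-invʳ  : ∀ x → x + (- x) ≡ 0r
    *-assoc : ∀ x y z → (x * y) * z ≡ x * (y * z)
    *-comm  : ∀ x y → x * y ≡ y * x
    *-idʳ   : ∀ x → x * 1r ≡ x
    *-invʳ  : ∀ x → x ≢ 0r → Σ ℝ (λ y → x * y ≡ 1r)
    distribˡ : ∀ x y z → x * (y + z) ≡ x * y + x * z
    0≢1     : 0r ≢ 1r
    <-irrefl : ∀ x → ¬ (x < x)
    <-trans  : ∀ {x y z} → x < y → y < z → x < z
    <-trichotomy : ∀ x y → (x < y) ⊎ (x ≡ y) ⊎ (y < x)
    +-mono-< : ∀ {x y} z → x < y → x + z < y + z
    *-pos    : ∀ {x y} → 0r < x → 0r < y → 0r < x * y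
  _≤_ : ℝ → ℝ → Set
  x ≤ y = (x < y) ⊎ (x ≡ y)
  field
    complete : (P : ℝ → Set) → Σ ℝ P → Σ ℝ (λ b → ∀ x → P x → x ≤ b) →
               Σ ℝ (λ s → (∀ x → P x → x ≤ s) × (∀ b → (∀ x → P x → x ≤ b) → s ≤ b))

module Geometry (R : RealField) where
  open RealField R

  Vec : ℕ → Set
  Vec n = Fin n → ℝ

  sumF : ∀ {k} → (Fin k → ℝ) → ℝ
  sumF {zero}  f = 0r
  sumF {suc k} f = f zero + sumF (λ i → f (suc i))

  _≐_ : ∀ {n} → Vec n → Vec n → Set
  u ≐ v = ∀ j → u j ≡ v j

  0v : ∀ {n} → Vec n
  0v j = 0r

  lincomb : ∀ {n k} → (Fin k → ℝ) → (Fin k → Vec n) → Vec n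
  lincomb λs vs j = sumF (λ i → λs i * vs i j)

  _·_ : ∀ {n} → ℝ → Vec n → Vec n
  (c · v) j = c * v j

  -- E = {e_0,…,e_n} is the vertex set of a simplex: affinely independent
  AffinelyIndependent : ∀ {n k} → (Fin k → Vec n) → Set
  AffinelyIndependent {n} {k} e =
    (λs : Fin k → ℝ) → sumF λs ≡ 0r → lincomb λs e ≐ 0v → ∀ i → λs i ≡ 0r

  InPosHull : ∀ {n k} → (Fin k → Vec n) → Subset k → Vec n → Set
  InPosHull e T p =
    Σ (Fin _ → ℝ) λ λs → (∀ i → 0r ≤ λs i) × (∀ i → i ∉ T → λs i ≡ 0r) × (p ≐ lincomb λs e)

  IsSupport : ∀ {n k} → (Fin k → Vec n) → Vec n → Subset k → Set
  IsSupport e p T = InPosHull e T p × (∀ T' → T' ⊂ T → ¬ InPosHull e T' p)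

  ConicalPosition : ∀ {n k} → (Fin k → Vec n) → Set
  ConicalPosition {n} {k} y =
    (¬ Σ (Fin k → ℝ) λ λs → (∀ i → 0r ≤ λs i) × (sumF λs ≡ 1r) × (lincomb λs y ≐ 0v))
    × (∀ i → ¬ Σ (Fin k → ℝ) λ λs → (∀ l → 0r ≤ λs l) × (λs i ≡ 0r) × (y i ≐ lincomb λs y))

{-# OPTIONS --safe #-}
-- Since e₀ + ⋯ + eₙ = 0 and E is affinely independent, a point of ℝⁿ determines its coefficient
-- vector with respect to E up to an additive constant, and in these coordinates conical position
-- of n + 1 points becomes a system of strict inequalities. Write S_q = E ∖ {e_a} and
-- S_p = {e_a, e_b}. If S_r is neither of the two allowed sets then, according to which of e_a, e_b
-- lie in S_r, replacing one or two vertices of the simplex by p, q or r yields n + 1 points of X in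
-- conical position, contradicting the hypothesis.
module Submission where

open import Defs
open import Data.Nat using (ℕ; suc)
open import Data.Fin using (Fin)
open import Data.Fin.Subset using (Subset; _∩_; _∪_; _─_; _⊆_; ∣_∣)
open import Data.Product using (Σ; _×_)
open import Data.Sum using (_⊎_)
open import Relation.Nullary using (¬_)
open import Relation.Binary.PropositionalEquality using (_≡_; _≢_)

open import Level using (0ℓ)
open import Function using (_∘_)
open import Data.Empty using (⊥; ⊥-elim)
open import Data.Product using (_,_; ∃; proj₁; proj₂)
open import Data.Sum using (inj₁; inj₂)
open import Relation.Nullary using (Dec; yes; no)
open import Relation.Nullary.Decidable using (_→-dec_)
open import Relation.Binary.PropositionalEquality
  using (refl; sym; trans; cong; cong₂; subst; subst₂; isEquivalence; module ≡-Reasoning)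
import Data.Nat as ℕ
import Data.Nat.Properties as ℕ
open import Data.Fin using (zero; suc; _≟_)
open import Data.Fin.Properties using (¬∀⟶∃¬; punchInᵢ≢i)
open import Data.Fin.Subset using (_∈_; _∉_; ∁; ⁅_⁆; ⊤; outside) renaming (⊥ to ∅; _-_ to _∖_)
open import Data.Fin.Subset.Properties
  using (_∈?_; _⊆?_; ⊆-antisym; p⊆q⇒∣p∣≤∣q∣; ∣⊥∣≡0; ∣⁅x⁆∣≡1; x∈⁅y⁆⇒x≡y; x∉⁅y⁆⇒x≢y; ∣∁p∣≡n∸∣p∣;
         x∈∁p⇒x∉p; x∉p⇒x∈∁p; x∈p⇒∣p-x∣<∣p∣; x∈p⇒p-x⊂p; x∈p∧x≢y⇒x∈p-y; ∈⊤;
         x∈p∩q⁺; x∈p∪q⁺; x∈p∪q⁻; x∈p∧x∉q⇒x∈p─q)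
open import Data.Vec using (_∷_; there)
open import Data.Vec.Functional using (removeAt; updateAt)
open import Data.Vec.Functional.Properties using (updateAt-updates; updateAt-minimal)
open import Algebra.Bundles using (CommutativeRing)
open import Algebra.Consequences.Propositional using (comm∧idʳ⇒id; comm∧invʳ⇒inv; comm∧distrˡ⇒distrʳ)
import Algebra.Properties.Ring as RingProperties
import Algebra.Properties.Group as GroupProperties
import Algebra.Properties.Semiring.Sum as SumProperties

module OrderedField (R : RealField) where
  open RealField R

  commutativeRing : CommutativeRing 0ℓ 0ℓ
  commutativeRing = record
    { isCommutativeRing = record
      { isRing = record
        { +-isAbelianGroup = record
          { isGroup = record
            { isMonoid = record
              { isSemigroup = record
                { isMagma = record { isEquivalence = isEquivalence ; ∙-cong = cong₂ _+_ }
                ; assoc = +-assoc }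
              ; identity = comm∧idʳ⇒id +-comm +-idʳ }
            ; inverse = comm∧invʳ⇒inv +-comm +-invʳ
            ; ⁻¹-cong = cong -_ }
          ; comm = +-comm }
        ; *-cong = cong₂ _*_
        ; *-assoc = *-assoc
        ; *-identity = comm∧idʳ⇒id *-comm *-idʳ
        ; distrib = distribˡ , comm∧distrˡ⇒distrʳ *-comm distribˡ }
      ; *-comm = *-comm } }

  open CommutativeRing commutativeRing public
    using (+-identityˡ; *-identityˡ; -‿inverseˡ; zeroˡ; zeroʳ; distribʳ; semiring)
  open RingProperties (CommutativeRing.ring commutativeRing) public
    using (-‿distribˡ-*; -‿distribʳ-*; -1*x≈-x; -‿involutive)
  open GroupProperties (CommutativeRing.+-group commutativeRing) public
    using () renaming (∙-cancelʳ to +-cancelʳ)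

  x+-y≡z+-w⇒x+w≡z+y : ∀ {x y z w} → x + - y ≡ z + - w → x + w ≡ z + y
  x+-y≡z+-w⇒x+w≡z+y {x} {y} {z} {w} eq = begin
    x + w                ≡⟨ shift x y w ⟨
    (x + - y) + (y + w)  ≡⟨ cong₂ _+_ eq (+-comm y w) ⟩
    (z + - w) + (w + y)  ≡⟨ shift z w y ⟩
    z + y                ∎
    where
    open ≡-Reasoning
    shift : ∀ a b c → (a + - b) + (b + c) ≡ a + c
    shift a b c = begin
      (a + - b) + (b + c)  ≡⟨ +-assoc a (- b) (b + c) ⟩
      a + (- b + (b + c))  ≡⟨ cong (a +_) (+-assoc (- b) b c) ⟨
      a + ((- b + b) + c)  ≡⟨ cong (λ s → a + (s + c)) (-‿inverseˡ b) ⟩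
      a + (0r + c)         ≡⟨ cong (a +_) (+-identityˡ c) ⟩
      a + c                ∎

  ≤-refl : ∀ {x} → x ≤ x
  ≤-refl = inj₂ refl

  <⇒≢ : ∀ {x y} → x < y → x ≢ y
  <⇒≢ x<y refl = <-irrefl _ x<y

  <-≤-trans : ∀ {x y z} → x < y → y ≤ z → x < z
  <-≤-trans x<y (inj₁ y<z) = <-trans x<y y<z
  <-≤-trans x<y (inj₂ refl) = x<y

  ≤-<-trans : ∀ {x y z} → x ≤ y → y < z → x < z
  ≤-<-trans (inj₁ x<y) y<z = <-trans x<y y<z
  ≤-<-trans (inj₂ refl) y<z = y<z

  ≤-trans : ∀ {x y z} → x ≤ y → y ≤ z → x ≤ z
  ≤-trans (inj₁ x<y) y≤z = inj₁ (<-≤-trans x<y y≤z)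
  ≤-trans (inj₂ refl) y≤z = y≤z

  <⊎≥ : ∀ x y → (x < y) ⊎ (y ≤ x)
  <⊎≥ x y with <-trichotomy x y
  ... | inj₁ x<y = inj₁ x<y
  ... | inj₂ (inj₁ refl) = inj₂ ≤-refl
  ... | inj₂ (inj₂ y<x) = inj₂ (inj₁ y<x)

  +-monoʳ-< : ∀ {x y} z → x < y → z + x < z + y
  +-monoʳ-< {x} {y} z x<y = subst₂ _<_ (+-comm x z) (+-comm y z) (+-mono-< z x<y)

  +-monoˡ-≤ : ∀ {x y} z → x ≤ y → x + z ≤ y + z
  +-monoˡ-≤ z (inj₁ x<y) = inj₁ (+-mono-< z x<y)
  +-monoˡ-≤ z (inj₂ refl) = ≤-refl

  +-monoʳ-≤ : ∀ {x y} z → x ≤ y → z + x ≤ z + y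
  +-monoʳ-≤ z (inj₁ x<y) = inj₁ (+-monoʳ-< z x<y)
  +-monoʳ-≤ z (inj₂ refl) = ≤-refl

  +-mono-≤ : ∀ {a b c d} → a ≤ b → c ≤ d → a + c ≤ b + d
  +-mono-≤ {b = b} {c} a≤b c≤d = ≤-trans (+-monoˡ-≤ c a≤b) (+-monoʳ-≤ b c≤d)

  +-mono-<-≤ : ∀ {a b c d} → a < b → c ≤ d → a + c < b + d
  +-mono-<-≤ {b = b} {c} a<b c≤d = <-≤-trans (+-mono-< c a<b) (+-monoʳ-≤ b c≤d)

  +-mono-≤-< : ∀ {a b c d} → a ≤ b → c < d → a + c < b + d
  +-mono-≤-< {b = b} {c} a≤b c<d = ≤-<-trans (+-monoˡ-≤ c a≤b) (+-monoʳ-< b c<d)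

  x≤x+y : ∀ x {y} → 0r ≤ y → x ≤ x + y
  x≤x+y x 0≤y = subst (_≤ x + _) (+-idʳ x) (+-monoʳ-≤ x 0≤y)

  <⇒0<y-x : ∀ {x y} → x < y → 0r < y + - x
  <⇒0<y-x {x} x<y = subst (_< _) (+-invʳ x) (+-mono-< (- x) x<y)

  0<y-x⇒< : ∀ {x y} → 0r < y + - x → x < y
  0<y-x⇒< {x} {y} 0<y-x = subst₂ _<_ (+-identityˡ x) y-x+x≡y (+-mono-< x 0<y-x)
    where
    y-x+x≡y : y + - x + x ≡ y
    y-x+x≡y = trans (+-assoc y (- x) x) (trans (cong (y +_) (-‿inverseˡ x)) (+-idʳ y))

  ≤⇒0≤y-x : ∀ {x y} → x ≤ y → 0r ≤ y + - x
  ≤⇒0≤y-x (inj₁ x<y) = inj₁ (<⇒0<y-x x<y)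
  ≤⇒0≤y-x {x} (inj₂ refl) = inj₂ (sym (+-invʳ x))

  0<1 : 0r < 1r
  0<1 with <-trichotomy 0r 1r
  ... | inj₁ 0<1 = 0<1
  ... | inj₂ (inj₁ 0≡1) = ⊥-elim (0≢1 0≡1)
  ... | inj₂ (inj₂ 1<0) = ⊥-elim (<-irrefl 0r (<-trans 0<[-1]*[-1] (subst (_< 0r) (sym [-1]*[-1]≡1) 1<0)))
    where
    0<-1 : 0r < - 1r
    0<-1 = subst (0r <_) (+-identityˡ (- 1r)) (<⇒0<y-x 1<0)
    0<[-1]*[-1] : 0r < - 1r * - 1r
    0<[-1]*[-1] = *-pos 0<-1 0<-1
    [-1]*[-1]≡1 : - 1r * - 1r ≡ 1r
    [-1]*[-1]≡1 = trans (-1*x≈-x (- 1r)) (-‿involutive 1r)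

  *-monoʳ-< : ∀ {c x y} → 0r < c → x < y → c * x < c * y
  *-monoʳ-< {c} {x} {y} 0<c x<y = 0<y-x⇒< (subst (0r <_) c[y-x]≡cy-cx (*-pos 0<c (<⇒0<y-x x<y)))
    where
    c[y-x]≡cy-cx : c * (y + - x) ≡ c * y + - (c * x)
    c[y-x]≡cy-cx = trans (distribˡ c y (- x)) (cong (c * y +_) (sym (-‿distribʳ-* c x)))

  *-monoʳ-≤ : ∀ {c x y} → 0r ≤ c → x ≤ y → c * x ≤ c * y
  *-monoʳ-≤ (inj₁ 0<c) (inj₁ x<y) = inj₁ (*-monoʳ-< 0<c x<y)
  *-monoʳ-≤ {x = x} {y} (inj₂ refl) (inj₁ _) = inj₂ (trans (zeroˡ x) (sym (zeroˡ y)))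
  *-monoʳ-≤ _ (inj₂ refl) = ≤-refl

  *-cancelˡ-pos : ∀ {c x y} → 0r < c → c * x ≡ c * y → x ≡ y
  *-cancelˡ-pos {x = x} {y} 0<c cx≡cy with <-trichotomy x y
  ... | inj₁ x<y = ⊥-elim (<⇒≢ (*-monoʳ-< 0<c x<y) cx≡cy)
  ... | inj₂ (inj₁ x≡y) = x≡y
  ... | inj₂ (inj₂ y<x) = ⊥-elim (<⇒≢ (*-monoʳ-< 0<c y<x) (sym cx≡cy))

module Sums (R : RealField) where
  open RealField R
  open Geometry R
  open OrderedField R
  open SumProperties semiring
    using (sum; sum-cong-≗; sum-replicate-zero; sum-remove; ∑-distrib-+; ∑-comm; *-distribˡ-sum; *-distribʳ-sum)

  sumF≡sum : ∀ {k} (f : Fin k → ℝ) → sumF f ≡ sum f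
  sumF≡sum {ℕ.zero} f = refl
  sumF≡sum {suc k} f = cong (f zero +_) (sumF≡sum (f ∘ suc))

  sumF-cong : ∀ {k} {f g : Fin k → ℝ} → (∀ i → f i ≡ g i) → sumF f ≡ sumF g
  sumF-cong {f = f} {g} f≗g = trans (sumF≡sum f) (trans (sum-cong-≗ f≗g) (sym (sumF≡sum g)))

  sumF-zero : ∀ {k} {f : Fin k → ℝ} → (∀ i → f i ≡ 0r) → sumF f ≡ 0r
  sumF-zero {k} {f} f≗0 = trans (sumF≡sum f) (trans (sum-cong-≗ f≗0) (sum-replicate-zero k))

  sumF-+ : ∀ {k} (f g : Fin k → ℝ) → sumF (λ i → f i + g i) ≡ sumF f + sumF g
  sumF-+ f g = trans (sumF≡sum (λ i → f i + g i))
    (trans (∑-distrib-+ f g) (sym (cong₂ _+_ (sumF≡sum f) (sumF≡sum g))))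

  sumF-*ˡ : ∀ {k} c (f : Fin k → ℝ) → sumF (λ i → c * f i) ≡ c * sumF f
  sumF-*ˡ c f = trans (sumF≡sum (λ i → c * f i))
    (trans (sym (*-distribˡ-sum c f)) (cong (c *_) (sym (sumF≡sum f))))

  sumF-const : ∀ {k} c → sumF {k} (λ _ → c) ≡ c * sumF {k} (λ _ → 1r)
  sumF-const {k} c = trans (sumF-cong {k} (λ _ → sym (*-idʳ c))) (sumF-*ˡ c (λ (_ : Fin k) → 1r))

  sumF-*ʳ : ∀ {k} c (f : Fin k → ℝ) → sumF (λ i → f i * c) ≡ sumF f * c
  sumF-*ʳ c f = trans (sumF≡sum (λ i → f i * c))
    (trans (sym (*-distribʳ-sum c f)) (cong (_* c) (sym (sumF≡sum f))))

  sumF-comm : ∀ {k l} (f : Fin k → Fin l → ℝ) →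
              sumF (λ i → sumF (f i)) ≡ sumF (λ j → sumF (λ i → f i j))
  sumF-comm f = begin
    sumF (λ i → sumF (f i))             ≡⟨ sumF-cong (λ i → sumF≡sum (f i)) ⟩
    sumF (λ i → sum (f i))              ≡⟨ sumF≡sum (λ i → sum (f i)) ⟩
    sum (λ i → sum (f i))               ≡⟨ ∑-comm f ⟩
    sum (λ j → sum (λ i → f i j))       ≡⟨ sumF≡sum (λ j → sum (λ i → f i j)) ⟨
    sumF (λ j → sum (λ i → f i j))      ≡⟨ sumF-cong (λ j → sumF≡sum (λ i → f i j)) ⟨
    sumF (λ j → sumF (λ i → f i j))     ∎
    where
      open ≡-Reasoning

  sumF-remove : ∀ {k} (f : Fin (suc k) → ℝ) i → sumF f ≡ f i + sumF (updateAt f i (λ _ → 0r))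
  sumF-remove {k} f i = begin
    sumF f                              ≡⟨ sumF≡sum f ⟩
    sum f                               ≡⟨ sum-remove f ⟩
    f i + sum (removeAt f i)            ≡⟨ cong (f i +_) (sum-cong-≗ {x = removeAt f i} unchanged) ⟩
    f i + sum (removeAt f₀ i)           ≡⟨ cong (f i +_) (+-identityˡ _) ⟨
    f i + (0r + sum (removeAt f₀ i))    ≡⟨ cong (λ z → f i + (z + sum (removeAt f₀ i))) (updateAt-updates i f) ⟨
    f i + (f₀ i + sum (removeAt f₀ i))  ≡⟨ cong (f i +_) (sum-remove f₀) ⟨
    f i + sum f₀                        ≡⟨ cong (f i +_) (sumF≡sum f₀) ⟨
    f i + sumF f₀                       ∎
    where
    open ≡-Reasoning
    f₀ : Fin (suc k) → ℝ
    f₀ = updateAt f i (λ _ → 0r)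
    unchanged : ∀ l → removeAt f i l ≡ removeAt f₀ i l
    unchanged l = sym (updateAt-minimal _ i f (punchInᵢ≢i i l))

  sumF-single : ∀ {k} (f : Fin k → ℝ) i → (∀ l → l ≢ i → f l ≡ 0r) → sumF f ≡ f i
  sumF-single {suc _} f i vanishes = begin
    sumF f                                   ≡⟨ sumF-remove f i ⟩
    f i + sumF (updateAt f i (λ _ → 0r))     ≡⟨ cong (f i +_) (sumF-zero f₀≗0) ⟩
    f i + 0r                                 ≡⟨ +-idʳ (f i) ⟩
    f i                                      ∎
    where
    open ≡-Reasoning
    f₀≗0 : ∀ l → updateAt f i (λ _ → 0r) l ≡ 0r
    f₀≗0 l with l ≟ i
    ... | yes refl = updateAt-updates i f
    ... | no l≢i = trans (updateAt-minimal l i f l≢i) (vanishes l l≢i)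

  sumF-nonneg : ∀ {k} (f : Fin k → ℝ) → (∀ i → 0r ≤ f i) → 0r ≤ sumF f
  sumF-nonneg {ℕ.zero} f 0≤f = ≤-refl
  sumF-nonneg {suc k} f 0≤f =
    subst (_≤ sumF f) (+-idʳ 0r) (+-mono-≤ (0≤f zero) (sumF-nonneg (f ∘ suc) (0≤f ∘ suc)))

  0<sumF1 : ∀ {k} → 0r < sumF {suc k} (λ _ → 1r)
  0<sumF1 {k} = subst (_< sumF {suc k} (λ _ → 1r)) (+-idʳ 0r)
    (+-mono-<-≤ 0<1 (sumF-nonneg {k} (λ _ → 1r) (λ _ → inj₁ 0<1)))

  sumF-pair : ∀ {k} (f : Fin (suc k) → ℝ) {i j} → j ≢ i →
              (∀ l → l ≢ i → l ≢ j → f l ≡ 0r) → sumF f ≡ f i + f j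
  sumF-pair f {i} {j} j≢i vanishes = trans (sumF-remove f i)
    (cong (f i +_) (trans (sumF-single f₀ j f₀-vanishes) (updateAt-minimal j i f j≢i)))
    where
    f₀ : Fin _ → ℝ
    f₀ = updateAt f i (λ _ → 0r)
    f₀-vanishes : ∀ l → l ≢ j → f₀ l ≡ 0r
    f₀-vanishes l l≢j with l ≟ i
    ... | yes refl = updateAt-updates i f
    ... | no l≢i = trans (updateAt-minimal l i f l≢i) (vanishes l l≢i l≢j)

  sumF-triple : ∀ {k} (f : Fin (suc k) → ℝ) {i j t} → j ≢ i → t ≢ i → t ≢ j →
                (∀ l → l ≢ i → l ≢ j → l ≢ t → f l ≡ 0r) → sumF f ≡ f i + f j + f t
  sumF-triple f {i} {j} {t} j≢i t≢i t≢j vanishes = begin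
    sumF f             ≡⟨ sumF-remove f i ⟩
    f i + sumF f₀      ≡⟨ cong (f i +_) (sumF-pair f₀ t≢j f₀-vanishes) ⟩
    f i + (f₀ j + f₀ t) ≡⟨ cong (f i +_) (cong₂ _+_ (updateAt-minimal j i f j≢i) (updateAt-minimal t i f t≢i)) ⟩
    f i + (f j + f t)  ≡⟨ +-assoc (f i) (f j) (f t) ⟨
    f i + f j + f t    ∎
    where
    open ≡-Reasoning
    f₀ : Fin _ → ℝ
    f₀ = updateAt f i (λ _ → 0r)
    f₀-vanishes : ∀ l → l ≢ j → l ≢ t → f₀ l ≡ 0r
    f₀-vanishes l l≢j l≢t with l ≟ i
    ... | yes refl = updateAt-updates i f
    ... | no l≢i = trans (updateAt-minimal l i f l≢i) (vanishes l l≢i l≢j l≢t)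

substitute : ∀ {a} {A : Set a} {k} (i j : Fin k) → A → A → (Fin k → A) → Fin k → A
substitute i j u v f l with l ≟ i | l ≟ j
... | yes _ | _     = u
... | no _  | yes _ = v
... | no _  | no _  = f l

module _ {a} {A : Set a} {k} {i j : Fin k} {u v : A} {f : Fin k → A} where

  substitute-i : substitute i j u v f i ≡ u
  substitute-i with i ≟ i
  ... | yes _ = refl
  ... | no i≢i = ⊥-elim (i≢i refl)

  substitute-j : j ≢ i → substitute i j u v f j ≡ v
  substitute-j j≢i with j ≟ i | j ≟ j
  ... | yes j≡i | _ = ⊥-elim (j≢i j≡i)
  ... | no _ | yes _ = refl
  ... | no _ | no j≢j = ⊥-elim (j≢j refl)

  substitute-other : ∀ {l} → l ≢ i → l ≢ j → substitute i j u v f l ≡ f l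
  substitute-other {l} l≢i l≢j with l ≟ i | l ≟ j
  ... | yes l≡i | _ = ⊥-elim (l≢i l≡i)
  ... | no _ | yes l≡j = ⊥-elim (l≢j l≡j)
  ... | no _ | no _ = refl

substitute-preserves : ∀ {a b r} {A : Set a} {B : Set b} (_∼_ : A → B → Set r) {k} (i j : Fin k)
                       {u v f u′ v′ g} → u ∼ u′ → v ∼ v′ → (∀ l → f l ∼ g l) →
                       ∀ l → substitute i j u v f l ∼ substitute i j u′ v′ g l
substitute-preserves _∼_ i j u∼u′ v∼v′ f∼g l with l ≟ i | l ≟ j
... | yes _ | _     = u∼u′
... | no _  | yes _ = v∼v′
... | no _  | no _  = f∼g l

avoid : ∀ {p k} {P : Fin k → Set p} {l₁ l₂} → l₁ ≢ l₂ → P l₁ → P l₂ → ∀ t → Σ (Fin k) λ l → P l × l ≢ t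
avoid {l₁ = l₁} l₁≢l₂ Pl₁ Pl₂ t with l₁ ≟ t
... | yes refl = _ , Pl₂ , l₁≢l₂ ∘ sym
... | no l₁≢t = _ , Pl₁ , l₁≢t

module Coordinates (R : RealField) where
  open RealField R
  open Geometry R
  open OrderedField R
  open Sums R

  NonNeg : ∀ {k} → (Fin k → ℝ) → Set
  NonNeg ν = ∀ i → 0r ≤ ν i

  Constant : ∀ {k} → (Fin k → ℝ) → Set
  Constant P = ∀ k l → P k ≡ P l

  infix 4 _≃_
  _≃_ : ∀ {k} → (Fin k → ℝ) → (Fin k → ℝ) → Set
  P ≃ Q = ∀ k l → P k + Q l ≡ P l + Q k

  ≃-violated : ∀ {k} {P Q : Fin k → ℝ} {a b} → P a + Q b < P b + Q a → ¬ P ≃ Q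
  ≃-violated {a = a} {b} lt P≃Q = <⇒≢ lt (P≃Q a b)

  δ : ∀ {k} → Fin k → Fin k → ℝ
  δ i l with l ≟ i
  ... | yes _ = 1r
  ... | no _ = 0r

  δ-same : ∀ {k} (i : Fin k) → δ i i ≡ 1r
  δ-same i with i ≟ i
  ... | yes _ = refl
  ... | no i≢i = ⊥-elim (i≢i refl)

  δ-diff : ∀ {k} {i l : Fin k} → l ≢ i → δ i l ≡ 0r
  δ-diff {i = i} {l} l≢i with l ≟ i
  ... | yes l≡i = ⊥-elim (l≢i l≡i)
  ... | no _ = refl

  δ-nonneg : ∀ {k} (i : Fin k) → NonNeg (δ i)
  δ-nonneg i l with l ≟ i
  ... | yes _ = inj₁ 0<1
  ... | no _ = ≤-refl

  ≃δ⇒constant-off : ∀ {k} {W : Fin k → ℝ} {t l l′} → W ≃ δ t → l ≢ t → l′ ≢ t → W l ≡ W l′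
  ≃δ⇒constant-off {W = W} {t} {l} {l′} W≃δt l≢t l′≢t = +-cancelʳ 0r (W l) (W l′) (begin
    W l + 0r        ≡⟨ cong (W l +_) (δ-diff l′≢t) ⟨
    W l + δ t l′    ≡⟨ W≃δt l l′ ⟩
    W l′ + δ t l    ≡⟨ cong (W l′ +_) (δ-diff l≢t) ⟩
    W l′ + 0r       ∎)
    where
      open ≡-Reasoning

  ¬≃δ : ∀ {k} {W : Fin k → ℝ} {t l} → W t ≡ 0r → W l ≡ 0r → l ≢ t → ¬ W ≃ δ t
  ¬≃δ {W = W} {t} {l} Wt≡0 Wl≡0 l≢t W≃δt = 0≢1 (begin
    0r              ≡⟨ +-idʳ 0r ⟨
    0r + 0r         ≡⟨ cong₂ _+_ Wt≡0 (δ-diff l≢t) ⟨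
    W t + δ t l     ≡⟨ W≃δt t l ⟩
    W l + δ t t     ≡⟨ cong₂ _+_ Wl≡0 (δ-same t) ⟩
    0r + 1r         ≡⟨ +-identityˡ 1r ⟩
    1r              ∎)
    where
      open ≡-Reasoning

  lincomb-+ : ∀ {n k} (P Q : Fin k → ℝ) (y : Fin k → Vec n) j →
              lincomb (λ l → P l + Q l) y j ≡ lincomb P y j + lincomb Q y j
  lincomb-+ P Q y j = trans (sumF-cong (λ l → distribʳ (y l j) (P l) (Q l)))
                            (sumF-+ (λ l → P l * y l j) (λ l → Q l * y l j))

  lincomb-*ˡ : ∀ {n k} c (P : Fin k → ℝ) (y : Fin k → Vec n) j →
               lincomb (λ l → c * P l) y j ≡ c * lincomb P y j
  lincomb-*ˡ c P y j = trans (sumF-cong (λ l → *-assoc c (P l) (y l j))) (sumF-*ˡ c (λ l → P l * y l j))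

  lincomb-neg : ∀ {n k} (P : Fin k → ℝ) (y : Fin k → Vec n) j → lincomb (λ l → - P l) y j ≡ - lincomb P y j
  lincomb-neg P y j = trans (sumF-cong (λ l → cong (_* y l j) (sym (-1*x≈-x (P l)))))
                            (trans (lincomb-*ˡ (- 1r) P y j) (-1*x≈-x (lincomb P y j)))

  lincomb-const : ∀ {n k} c (y : Fin k → Vec n) j → lincomb (λ _ → c) y j ≡ c * lincomb (λ _ → 1r) y j
  lincomb-const c y j = trans (sumF-cong (λ l → cong (_* y l j) (sym (*-idʳ c)))) (lincomb-*ˡ c (λ _ → 1r) y j)

  lincomb-zero : ∀ {n k} (y : Fin k → Vec n) → lincomb (λ _ → 0r) y ≐ 0v
  lincomb-zero y j = sumF-zero (λ l → zeroˡ (y l j))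

  lincomb-δ : ∀ {n k} (y : Fin k → Vec n) b → lincomb (δ b) y ≐ y b
  lincomb-δ y b j = trans (sumF-single (λ l → δ b l * y l j) b vanishes)
                          (trans (cong (_* y b j) (δ-same b)) (*-identityˡ (y b j)))
    where
    vanishes : ∀ l → l ≢ b → δ b l * y l j ≡ 0r
    vanishes l l≢b = trans (cong (_* y l j) (δ-diff l≢b)) (zeroˡ (y l j))

  combination : ∀ {K k} → (Fin K → Fin k → ℝ) → (Fin K → ℝ) → Fin k → ℝ
  combination Λ ν t = sumF (λ l → ν l * Λ l t)

  lincomb-combination : ∀ {n k K} (e : Fin k → Vec n) (Λ : Fin K → Fin k → ℝ) (y : Fin K → Vec n) →
                        (∀ l → y l ≐ lincomb (Λ l) e) → ∀ ν → lincomb ν y ≐ lincomb (combination Λ ν) e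
  lincomb-combination e Λ y y≐Λe ν j = begin
    sumF (λ l → ν l * y l j)
      ≡⟨ sumF-cong (λ l → cong (ν l *_) (y≐Λe l j)) ⟩
    sumF (λ l → ν l * sumF (λ t → Λ l t * e t j))
      ≡⟨ sumF-cong (λ l → sumF-*ˡ (ν l) (λ t → Λ l t * e t j)) ⟨
    sumF (λ l → sumF (λ t → ν l * (Λ l t * e t j)))
      ≡⟨ sumF-comm (λ l t → ν l * (Λ l t * e t j)) ⟩
    sumF (λ t → sumF (λ l → ν l * (Λ l t * e t j)))
      ≡⟨ sumF-cong (λ t → sumF-cong (λ l → *-assoc (ν l) (Λ l t) (e t j))) ⟨
    sumF (λ t → sumF (λ l → ν l * Λ l t * e t j))
      ≡⟨ sumF-cong (λ t → sumF-*ʳ (e t j) (λ l → ν l * Λ l t)) ⟩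
    sumF (λ t → combination Λ ν t * e t j) ∎
    where
      open ≡-Reasoning

  conicalPosition⇒injective : ∀ {n k} {y : Fin k → Vec n} → ConicalPosition y → ∀ {a b} → y a ≐ y b → a ≡ b
  conicalPosition⇒injective {y = y} (_ , no-positive) {a} {b} ya≐yb with a ≟ b
  ... | yes a≡b = a≡b
  ... | no a≢b = ⊥-elim (no-positive a (δ b , δ-nonneg b , δ-diff a≢b , ya≐δy))
    where
    ya≐δy : y a ≐ lincomb (δ b) y
    ya≐δy j = trans (ya≐yb j) (sym (lincomb-δ y b j))

  -- Conical position of a family whose l-th point has coefficient vector Λ l, read through
  -- lincomb-injective: Σ ν_l y_l = 0 means constant coefficients, and y_t = Σ ν_l y_l means
  -- coefficients differing from Λ t by a constant.
  ConicalCoordinates : ∀ {K k} → (Fin K → Fin k → ℝ) → Set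
  ConicalCoordinates Λ =
    (∀ ν → NonNeg ν → sumF ν ≡ 1r → ¬ Constant (combination Λ ν)) ×
    (∀ t ν → NonNeg ν → ν t ≡ 0r → ¬ combination Λ ν ≃ Λ t)

  0*x≡0*y : ∀ {c} → c ≡ 0r → ∀ x y → c * x ≡ c * y
  0*x≡0*y refl x y = trans (zeroˡ x) (sym (zeroˡ y))

  index-<⇒≢ : ∀ {k} {f : Fin k → ℝ} {a b} → f a < f b → a ≢ b
  index-<⇒≢ fa<fb refl = <-irrefl _ fa<fb

  -- The simplex with e_i and e_j replaced by points with coefficient vectors U and V: A ν are the
  -- coefficients of Σ ν_l y_l, and mix ν is the part contributed by the two new points.
  module Substitution {n} (i j : Fin (suc n)) (j≢i : j ≢ i) (U V : Fin (suc n) → ℝ) where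

    Λ : Fin (suc n) → Fin (suc n) → ℝ
    Λ = substitute i j U V δ

    A : (Fin (suc n) → ℝ) → Fin (suc n) → ℝ
    A = combination Λ

    mix : (Fin (suc n) → ℝ) → Fin (suc n) → ℝ
    mix ν k = ν i * U k + ν j * V k

    Λ-i : Λ i ≡ U
    Λ-i = substitute-i {i = i} {j} {U} {V} {δ}

    Λ-j : Λ j ≡ V
    Λ-j = substitute-j {i = i} {j} {U} {V} {δ} j≢i

    Λ-other : ∀ {t} → t ≢ i → t ≢ j → Λ t ≡ δ t
    Λ-other = substitute-other {i = i} {j} {U} {V} {δ}

    index-cases : ∀ t → t ≡ i ⊎ t ≡ j ⊎ (t ≢ i × t ≢ j)
    index-cases t with t ≟ i | t ≟ j
    ... | yes t≡i | _ = inj₁ t≡i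
    ... | no _ | yes t≡j = inj₂ (inj₁ t≡j)
    ... | no t≢i | no t≢j = inj₂ (inj₂ (t≢i , t≢j))

    private
      off-diagonal : ∀ (ν : Fin (suc n) → ℝ) {k l} → l ≢ i → l ≢ j → l ≢ k → ν l * Λ l k ≡ 0r
      off-diagonal ν {k} {l} l≢i l≢j l≢k =
        trans (cong (λ row → ν l * row k) (Λ-other {l} l≢i l≢j))
              (trans (cong (ν l *_) (δ-diff {i = l} {k} (l≢k ∘ sym))) (zeroʳ (ν l)))

      pair : ∀ (ν : Fin (suc n) → ℝ) k → (∀ l → l ≢ i → l ≢ j → ν l * Λ l k ≡ 0r) → A ν k ≡ mix ν k
      pair ν k vanishes = trans (sumF-pair (λ l → ν l * Λ l k) {i} {j} j≢i vanishes)
        (cong₂ _+_ (cong (λ row → ν i * row k) Λ-i) (cong (λ row → ν j * row k) Λ-j))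

    A-i : ∀ (ν : Fin (suc n) → ℝ) → A ν i ≡ mix ν i
    A-i ν = pair ν i (λ l l≢i l≢j → off-diagonal ν l≢i l≢j l≢i)

    A-j : ∀ (ν : Fin (suc n) → ℝ) → A ν j ≡ mix ν j
    A-j ν = pair ν j (λ l l≢i l≢j → off-diagonal ν l≢i l≢j l≢j)

    A-other : ∀ (ν : Fin (suc n) → ℝ) {k} → k ≢ i → k ≢ j → A ν k ≡ mix ν k + ν k
    A-other ν {k} k≢i k≢j = trans
      (sumF-triple (λ l → ν l * Λ l k) {i} {j} {k} j≢i k≢i k≢j (λ l l≢i l≢j l≢k → off-diagonal ν l≢i l≢j l≢k))
      (cong₂ _+_ (cong₂ _+_ (cong (λ row → ν i * row k) Λ-i) (cong (λ row → ν j * row k) Λ-j))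
                 (trans (cong (λ row → ν k * row k) (Λ-other {k} k≢i k≢j))
                        (trans (cong (ν k *_) (δ-same k)) (*-idʳ (ν k)))))

    mix≤A-other : ∀ {ν} → NonNeg ν → ∀ {k} → k ≢ i → k ≢ j → mix ν k ≤ A ν k
    mix≤A-other {ν} ν≥0 {k} k≢i k≢j = subst (mix ν k ≤_) (sym (A-other ν k≢i k≢j)) (x≤x+y (mix ν k) (ν≥0 k))

    A-j<A-other : ∀ {ν} → NonNeg ν → ∀ {k} → k ≢ i → k ≢ j → mix ν j < mix ν k → A ν j < A ν k
    A-j<A-other {ν} ν≥0 {k} k≢i k≢j mixj<mixk =
      subst (_< A ν k) (sym (A-j ν)) (<-≤-trans mixj<mixk (mix≤A-other ν≥0 k≢i k≢j))

    mix-vanishes : ∀ {ν} → ν i ≡ 0r → ν j ≡ 0r → ∀ k → mix ν k ≡ 0r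
    mix-vanishes {ν} νi≡0 νj≡0 k = begin
      ν i * U k + ν j * V k   ≡⟨ cong₂ _+_ (cong (_* U k) νi≡0) (cong (_* V k) νj≡0) ⟩
      0r * U k + 0r * V k     ≡⟨ cong₂ _+_ (zeroˡ (U k)) (zeroˡ (V k)) ⟩
      0r + 0r                 ≡⟨ +-idʳ 0r ⟩
      0r                      ∎
      where
        open ≡-Reasoning

    A≗ν : ∀ {ν} → ν i ≡ 0r → ν j ≡ 0r → ∀ k → A ν k ≡ ν k
    A≗ν {ν} νi≡0 νj≡0 k with index-cases k
    ... | inj₁ refl = trans (A-i ν) (trans (mix-vanishes νi≡0 νj≡0 i) (sym νi≡0))
    ... | inj₂ (inj₁ refl) = trans (A-j ν) (trans (mix-vanishes νi≡0 νj≡0 j) (sym νj≡0))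
    ... | inj₂ (inj₂ (k≢i , k≢j)) =
      trans (A-other ν k≢i k≢j) (trans (cong (_+ ν k) (mix-vanishes νi≡0 νj≡0 k)) (+-identityˡ (ν k)))

    vanishing⇒¬constant : ∀ {ν} → ν i ≡ 0r → ν j ≡ 0r → sumF ν ≡ 1r → ¬ Constant (A ν)
    vanishing⇒¬constant {ν} νi≡0 νj≡0 Σν≡1 A-constant = 0≢1 (trans (sym (sumF-zero ν≗0)) Σν≡1)
      where
      ν≗0 : ∀ k → ν k ≡ 0r
      ν≗0 k = trans (sym (A≗ν νi≡0 νj≡0 k)) (trans (A-constant k i) (trans (A≗ν νi≡0 νj≡0 i) νi≡0))

    vanishing⇒¬≃δ : ∀ {ν t} → ν i ≡ 0r → ν j ≡ 0r → ν t ≡ 0r → t ≢ j → ¬ A ν ≃ δ t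
    vanishing⇒¬≃δ νi≡0 νj≡0 νt≡0 t≢j =
      ¬≃δ (trans (A≗ν νi≡0 νj≡0 _) νt≡0) (trans (A≗ν νi≡0 νj≡0 j) νj≡0) (t≢j ∘ sym)

    vanishing⇒¬≃ : ∀ {ν W} → ν i ≡ 0r → ν j ≡ 0r → W j < W i → ¬ A ν ≃ W
    vanishing⇒¬≃ {W = W} νi≡0 νj≡0 Wj<Wi = ≃-violated {a = i} {j}
      (subst₂ (λ x y → x + W j < y + W i) (sym (trans (A≗ν νi≡0 νj≡0 i) νi≡0))
              (sym (trans (A≗ν νi≡0 νj≡0 j) νj≡0)) (+-monoʳ-< 0r Wj<Wi))

    mix-j≡mix-i : ∀ ν → A ν i ≡ A ν j → mix ν j ≡ mix ν i
    mix-j≡mix-i ν Ai≡Aj = trans (sym (A-j ν)) (trans (sym Ai≡Aj) (A-i ν))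

    conical-agreeing : ∀ {l₁ l₂} → U j < U i → V j < V i →
                       U l₁ ≤ U j → V j < V l₁ → V l₂ ≤ V j → U j < U l₂ → ConicalCoordinates Λ
    conical-agreeing {l₁} {l₂} Uj<Ui Vj<Vi Ul₁≤Uj Vj<Vl₁ Vl₂≤Vj Uj<Ul₂ = no-convex , no-positive
      where
      l₁≢i : l₁ ≢ i
      l₁≢i = index-<⇒≢ {f = U} (≤-<-trans Ul₁≤Uj Uj<Ui)
      l₁≢j : l₁ ≢ j
      l₁≢j = index-<⇒≢ {f = V} Vj<Vl₁ ∘ sym
      l₂≢i : l₂ ≢ i
      l₂≢i = index-<⇒≢ {f = V} (≤-<-trans Vl₂≤Vj Vj<Vi)
      l₂≢j : l₂ ≢ j
      l₂≢j = index-<⇒≢ {f = U} Uj<Ul₂ ∘ sym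

      weights-vanish : ∀ {ν} → NonNeg ν → A ν i ≡ A ν j → ν i ≡ 0r × ν j ≡ 0r
      weights-vanish {ν} ν≥0 Ai≡Aj with ν≥0 i | ν≥0 j
      ... | inj₁ 0<νi | _ = ⊥-elim (<⇒≢
            (+-mono-<-≤ (*-monoʳ-< 0<νi Uj<Ui) (*-monoʳ-≤ (ν≥0 j) (inj₁ Vj<Vi))) (mix-j≡mix-i ν Ai≡Aj))
      ... | inj₂ _ | inj₁ 0<νj = ⊥-elim (<⇒≢
            (+-mono-≤-< (*-monoʳ-≤ (ν≥0 i) (inj₁ Uj<Ui)) (*-monoʳ-< 0<νj Vj<Vi)) (mix-j≡mix-i ν Ai≡Aj))
      ... | inj₂ 0≡νi | inj₂ 0≡νj = sym 0≡νi , sym 0≡νj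

      no-convex : ∀ ν → NonNeg ν → sumF ν ≡ 1r → ¬ Constant (A ν)
      no-convex ν ν≥0 Σν≡1 A-constant with weights-vanish ν≥0 (A-constant i j)
      ... | νi≡0 , νj≡0 = vanishing⇒¬constant νi≡0 νj≡0 Σν≡1 A-constant

      u∉hull : ∀ {ν} → NonNeg ν → ν i ≡ 0r → ¬ A ν ≃ U
      u∉hull {ν} ν≥0 νi≡0 with ν≥0 j
      ... | inj₂ 0≡νj = vanishing⇒¬≃ νi≡0 (sym 0≡νj) Uj<Ui
      ... | inj₁ 0<νj = ≃-violated {a = j} {l₁} (+-mono-<-≤ (A-j<A-other ν≥0 l₁≢i l₁≢j mixj<mixl₁) Ul₁≤Uj)
        where
        mixj<mixl₁ : mix ν j < mix ν l₁
        mixj<mixl₁ = +-mono-≤-< (inj₂ (0*x≡0*y νi≡0 (U j) (U l₁))) (*-monoʳ-< 0<νj Vj<Vl₁)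

      v∉hull : ∀ {ν} → NonNeg ν → ν j ≡ 0r → ¬ A ν ≃ V
      v∉hull {ν} ν≥0 νj≡0 with ν≥0 i
      ... | inj₂ 0≡νi = vanishing⇒¬≃ (sym 0≡νi) νj≡0 Vj<Vi
      ... | inj₁ 0<νi = ≃-violated {a = j} {l₂} (+-mono-<-≤ (A-j<A-other ν≥0 l₂≢i l₂≢j mixj<mixl₂) Vl₂≤Vj)
        where
        mixj<mixl₂ : mix ν j < mix ν l₂
        mixj<mixl₂ = +-mono-<-≤ (*-monoʳ-< 0<νi Uj<Ul₂) (inj₂ (0*x≡0*y νj≡0 (V j) (V l₂)))

      vertex∉hull : ∀ {ν t} → NonNeg ν → ν t ≡ 0r → t ≢ i → t ≢ j → ¬ A ν ≃ δ t
      vertex∉hull ν≥0 νt≡0 t≢i t≢j A≃δt with weights-vanish ν≥0 (≃δ⇒constant-off A≃δt (t≢i ∘ sym) (t≢j ∘ sym))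
      ... | νi≡0 , νj≡0 = vanishing⇒¬≃δ νi≡0 νj≡0 νt≡0 t≢j A≃δt

      no-positive : ∀ t ν → NonNeg ν → ν t ≡ 0r → ¬ A ν ≃ Λ t
      no-positive t ν ν≥0 νt≡0 with index-cases t
      ... | inj₁ refl = u∉hull ν≥0 νt≡0 ∘ subst (A ν ≃_) Λ-i
      ... | inj₂ (inj₁ refl) = v∉hull ν≥0 νt≡0 ∘ subst (A ν ≃_) Λ-j
      ... | inj₂ (inj₂ (t≢i , t≢j)) = vertex∉hull ν≥0 νt≡0 t≢i t≢j ∘ subst (A ν ≃_) (Λ-other t≢i t≢j)

    Dominates : Fin (suc n) → Fin (suc n) → Set
    Dominates k l = U k ≤ U l × V k ≤ V l × (U k < U l ⊎ V k < V l)

    conical-opposed : ∀ {l₁ l₂} → l₁ ≢ l₂ → U i < U j → V j < V i → Dominates j l₁ → Dominates j l₂ →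
                ConicalCoordinates Λ
    conical-opposed {l₁} l₁≢l₂ Ui<Uj Vj<Vi j≺l₁ j≺l₂ = no-convex , no-positive
      where
      weights-agree : ∀ {ν} → NonNeg ν → A ν i ≡ A ν j → (ν i ≡ 0r × ν j ≡ 0r) ⊎ (0r < ν i × 0r < ν j)
      weights-agree {ν} ν≥0 Ai≡Aj with ν≥0 i | ν≥0 j
      ... | inj₁ 0<νi | inj₁ 0<νj = inj₂ (0<νi , 0<νj)
      ... | inj₂ 0≡νi | inj₂ 0≡νj = inj₁ (sym 0≡νi , sym 0≡νj)
      ... | inj₂ 0≡νi | inj₁ 0<νj = ⊥-elim (<⇒≢
            (+-mono-≤-< (inj₂ (0*x≡0*y (sym 0≡νi) (U j) (U i))) (*-monoʳ-< 0<νj Vj<Vi)) (mix-j≡mix-i ν Ai≡Aj))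
      ... | inj₁ 0<νi | inj₂ 0≡νj = ⊥-elim (<⇒≢
            (+-mono-<-≤ (*-monoʳ-< 0<νi Ui<Uj) (inj₂ (0*x≡0*y (sym 0≡νj) (V i) (V j))))
            (sym (mix-j≡mix-i ν Ai≡Aj)))

      above : ∀ {ν l} → NonNeg ν → 0r < ν i → 0r < ν j → Dominates j l → A ν j < A ν l
      above ν≥0 0<νi 0<νj (Uj≤Ul , Vj≤Vl , inj₁ Uj<Ul) =
        A-j<A-other ν≥0 (index-<⇒≢ {f = U} (<-≤-trans Ui<Uj Uj≤Ul) ∘ sym) (index-<⇒≢ {f = U} Uj<Ul ∘ sym)
          (+-mono-<-≤ (*-monoʳ-< 0<νi Uj<Ul) (*-monoʳ-≤ (inj₁ 0<νj) Vj≤Vl))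
      above ν≥0 0<νi 0<νj (Uj≤Ul , Vj≤Vl , inj₂ Vj<Vl) =
        A-j<A-other ν≥0 (index-<⇒≢ {f = U} (<-≤-trans Ui<Uj Uj≤Ul) ∘ sym) (index-<⇒≢ {f = V} Vj<Vl ∘ sym)
          (+-mono-≤-< (*-monoʳ-≤ (inj₁ 0<νi) Uj≤Ul) (*-monoʳ-< 0<νj Vj<Vl))

      no-convex : ∀ ν → NonNeg ν → sumF ν ≡ 1r → ¬ Constant (A ν)
      no-convex ν ν≥0 Σν≡1 A-constant with weights-agree ν≥0 (A-constant i j)
      ... | inj₁ (νi≡0 , νj≡0) = vanishing⇒¬constant νi≡0 νj≡0 Σν≡1 A-constant
      ... | inj₂ (0<νi , 0<νj) = <⇒≢ (above ν≥0 0<νi 0<νj j≺l₁) (A-constant j l₁)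

      vertex∉hull : ∀ {ν t} → NonNeg ν → ν t ≡ 0r → t ≢ i → t ≢ j → ¬ A ν ≃ δ t
      vertex∉hull {t = t} ν≥0 νt≡0 t≢i t≢j A≃δt
        with weights-agree ν≥0 (≃δ⇒constant-off A≃δt (t≢i ∘ sym) (t≢j ∘ sym))
      ... | inj₁ (νi≡0 , νj≡0) = vanishing⇒¬≃δ νi≡0 νj≡0 νt≡0 t≢j A≃δt
      ... | inj₂ (0<νi , 0<νj) with avoid l₁≢l₂ j≺l₁ j≺l₂ t
      ...   | l , j≺l , l≢t = <⇒≢ (above ν≥0 0<νi 0<νj j≺l) (≃δ⇒constant-off A≃δt (t≢j ∘ sym) l≢t)

      no-positive : ∀ t ν → NonNeg ν → ν t ≡ 0r → ¬ A ν ≃ Λ t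
      no-positive t ν ν≥0 νt≡0 with index-cases t
      ... | inj₁ refl = ≃-violated {a = j} {i} (+-mono-≤-< Aj≤Ai Ui<Uj) ∘ subst (A ν ≃_) Λ-i
        where
        Aj≤Ai : A ν j ≤ A ν i
        Aj≤Ai = subst₂ _≤_ (sym (A-j ν)) (sym (A-i ν))
          (+-mono-≤ (inj₂ (0*x≡0*y νt≡0 (U j) (U i))) (*-monoʳ-≤ (ν≥0 j) (inj₁ Vj<Vi)))
      ... | inj₂ (inj₁ refl) = ≃-violated {a = i} {j} (+-mono-≤-< Ai≤Aj Vj<Vi) ∘ subst (A ν ≃_) Λ-j
        where
        Ai≤Aj : A ν i ≤ A ν j
        Ai≤Aj = subst₂ _≤_ (sym (A-i ν)) (sym (A-j ν))
          (+-mono-≤ (*-monoʳ-≤ (ν≥0 i) (inj₁ Ui<Uj)) (inj₂ (0*x≡0*y νt≡0 (V i) (V j))))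
      ... | inj₂ (inj₂ (t≢i , t≢j)) = vertex∉hull ν≥0 νt≡0 t≢i t≢j ∘ subst (A ν ≃_) (Λ-other t≢i t≢j)

  -- Here only e_j is replaced: the row δ i of e_i is kept.
  conical-single : ∀ {n} {i j l₁ l₂ : Fin (suc n)} {V : Fin (suc n) → ℝ} → l₁ ≢ l₂ →
              V i < V j → V j < V l₁ → V j < V l₂ → ConicalCoordinates (substitute i j (δ i) V δ)
  conical-single {i = i} {j} {l₁} {V = V} l₁≢l₂ Vi<Vj Vj<Vl₁ Vj<Vl₂ = no-convex , no-positive
    where
    j≢i : j ≢ i
    j≢i = index-<⇒≢ {f = V} Vi<Vj ∘ sym
    open Substitution i j j≢i (δ i) V

    Λ-≢j : ∀ {t} → t ≢ j → Λ t ≡ δ t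
    Λ-≢j {t} t≢j with index-cases t
    ... | inj₁ refl = Λ-i
    ... | inj₂ (inj₁ t≡j) = ⊥-elim (t≢j t≡j)
    ... | inj₂ (inj₂ (t≢i , _)) = Λ-other t≢i t≢j

    mix-i≡νi : ∀ {ν} → ν j ≡ 0r → mix ν i ≡ ν i
    mix-i≡νi {ν} νj≡0 = trans (cong₂ _+_ (trans (cong (ν i *_) (δ-same i)) (*-idʳ (ν i))) (cong (_* V i) νj≡0))
                            (trans (cong (ν i +_) (zeroˡ (V i))) (+-idʳ (ν i)))

    mix-j≡0 : ∀ {ν} → ν j ≡ 0r → mix ν j ≡ 0r
    mix-j≡0 {ν} νj≡0 = trans (cong₂ _+_ (trans (cong (ν i *_) (δ-diff j≢i)) (zeroʳ (ν i))) (cong (_* V j) νj≡0))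
                           (trans (cong (0r +_) (zeroˡ (V j))) (+-idʳ 0r))

    νj-vanishes : ∀ {ν l} → NonNeg ν → V j < V l → A ν j ≡ A ν l → ν j ≡ 0r
    νj-vanishes {ν} {l} ν≥0 Vj<Vl Aj≡Al with ν≥0 j
    ... | inj₂ 0≡νj = sym 0≡νj
    ... | inj₁ 0<νj = ⊥-elim (<⇒≢ (A-j<A-other ν≥0 l≢i l≢j mixj<mixl) Aj≡Al)
      where
      l≢i : l ≢ i
      l≢i = index-<⇒≢ {f = V} (<-trans Vi<Vj Vj<Vl) ∘ sym
      l≢j : l ≢ j
      l≢j = index-<⇒≢ {f = V} Vj<Vl ∘ sym
      mixj<mixl : mix ν j < mix ν l
      mixj<mixl = +-mono-≤-< (inj₂ (cong (ν i *_) (trans (δ-diff j≢i) (sym (δ-diff l≢i)))))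
                             (*-monoʳ-< 0<νj Vj<Vl)

    νi-vanishes : ∀ {ν} → ν j ≡ 0r → A ν i ≡ A ν j → ν i ≡ 0r
    νi-vanishes {ν} νj≡0 Ai≡Aj = trans (sym (mix-i≡νi νj≡0)) (trans (sym (mix-j≡mix-i ν Ai≡Aj)) (mix-j≡0 νj≡0))

    no-convex : ∀ ν → NonNeg ν → sumF ν ≡ 1r → ¬ Constant (A ν)
    no-convex ν ν≥0 Σν≡1 A-constant = vanishing⇒¬constant νi≡0 νj≡0 Σν≡1 A-constant
      where
      νj≡0 : ν j ≡ 0r
      νj≡0 = νj-vanishes ν≥0 Vj<Vl₁ (A-constant j l₁)
      νi≡0 : ν i ≡ 0r
      νi≡0 = νi-vanishes νj≡0 (A-constant i j)

    vertex∉hull : ∀ {ν t} → NonNeg ν → ν t ≡ 0r → t ≢ j → ¬ A ν ≃ δ t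
    vertex∉hull {ν} {t} ν≥0 νt≡0 t≢j A≃δt with avoid l₁≢l₂ Vj<Vl₁ Vj<Vl₂ t
    ... | l , Vj<Vl , l≢t = vanishing⇒¬≃δ νi≡0 νj≡0 νt≡0 t≢j A≃δt
      where
      νj≡0 : ν j ≡ 0r
      νj≡0 = νj-vanishes ν≥0 Vj<Vl (≃δ⇒constant-off A≃δt (t≢j ∘ sym) l≢t)
      νi≡0 : ν i ≡ 0r
      νi≡0 with t ≟ i
      ... | yes refl = νt≡0
      ... | no t≢i = νi-vanishes νj≡0 (≃δ⇒constant-off A≃δt (t≢i ∘ sym) (t≢j ∘ sym))

    no-positive : ∀ t ν → NonNeg ν → ν t ≡ 0r → ¬ A ν ≃ Λ t
    no-positive t ν ν≥0 νt≡0 with j ≟ t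
    ... | yes refl = ≃-violated {a = j} {i} (+-mono-≤-< Aj≤Ai Vi<Vj) ∘ subst (A ν ≃_) Λ-j
      where
      Aj≤Ai : A ν j ≤ A ν i
      Aj≤Ai = subst₂ _≤_ (sym (trans (A-j ν) (mix-j≡0 νt≡0))) (sym (trans (A-i ν) (mix-i≡νi νt≡0))) (ν≥0 i)
    ... | no j≢t = vertex∉hull ν≥0 νt≡0 (j≢t ∘ sym) ∘ subst (A ν ≃_) (Λ-≢j (j≢t ∘ sym))

⊈⇒∃ : ∀ {k} {p q : Subset k} → ¬ p ⊆ q → ∃ λ x → x ∈ p × x ∉ q
⊈⇒∃ {k} {p} {q} p⊈q with ¬∀⟶∃¬ k (λ x → x ∈ p → x ∈ q) (λ x → x ∈? p →-dec x ∈? q) (λ h → p⊈q (h _))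
... | x , ¬[x∈p⇒x∈q] with x ∈? p
...   | yes x∈p = x , x∈p , λ x∈q → ¬[x∈p⇒x∈q] (λ _ → x∈q)
...   | no x∉p = ⊥-elim (¬[x∈p⇒x∈q] (⊥-elim ∘ x∉p))

∈∧∉⇒≢ : ∀ {k} {p : Subset k} {x y} → x ∈ p → y ∉ p → x ≢ y
∈∧∉⇒≢ x∈p y∉p refl = y∉p x∈p

x∈p─q⇒x∉q : ∀ {k} {x : Fin k} {p q : Subset k} → x ∈ p ─ q → x ∉ q
x∈p─q⇒x∉q {x = zero} {_ ∷ _} {outside ∷ _} _ ()
x∈p─q⇒x∉q {x = suc _} {_ ∷ _} {_ ∷ _} (there x∈p─q) (there x∈q) = x∈p─q⇒x∉q x∈p─q x∈q

1≤∣p∣⇒∃∈ : ∀ {k} {p : Subset k} → 1 ℕ.≤ ∣ p ∣ → ∃ λ x → x ∈ p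
1≤∣p∣⇒∃∈ {k} {p} 1≤∣p∣ with p ⊆? ∅
... | yes p⊆∅ = ⊥-elim (ℕ.<⇒≱ 1≤∣p∣ (subst (∣ p ∣ ℕ.≤_) (∣⊥∣≡0 k) (p⊆q⇒∣p∣≤∣q∣ p⊆∅)))
... | no p⊈∅ with ⊈⇒∃ p⊈∅
...   | x , x∈p , _ = x , x∈p

distinct⇒2≤∣p∣ : ∀ {k} {p : Subset k} {x y} → x ∈ p → y ∈ p → x ≢ y → 2 ℕ.≤ ∣ p ∣
distinct⇒2≤∣p∣ {p = p} {x} {y} x∈p y∈p x≢y = ℕ.≤-trans (ℕ.s≤s 1≤∣p-x∣) (x∈p⇒∣p-x∣<∣p∣ x∈p)
  where
  1≤∣p-x∣ : 1 ℕ.≤ ∣ p ∖ x ∣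
  1≤∣p-x∣ = subst (ℕ._≤ ∣ p ∖ x ∣) (∣⁅x⁆∣≡1 y) (p⊆q⇒∣p∣≤∣q∣ λ z∈⁅y⁆ →
    subst (_∈ p ∖ x) (sym (x∈⁅y⁆⇒x≡y y z∈⁅y⁆)) (x∈p∧x≢y⇒x∈p-y y∈p (x≢y ∘ sym)))

2≤∣p∣⇒∃∈≢ : ∀ {k} {p : Subset k} → 2 ℕ.≤ ∣ p ∣ → ∀ x → ∃ λ y → y ∈ p × y ≢ x
2≤∣p∣⇒∃∈≢ {p = p} 2≤∣p∣ x with p ⊆? ⁅ x ⁆
... | yes p⊆⁅x⁆ = ⊥-elim (ℕ.<⇒≱ 2≤∣p∣ (subst (∣ p ∣ ℕ.≤_) (∣⁅x⁆∣≡1 x) (p⊆q⇒∣p∣≤∣q∣ p⊆⁅x⁆)))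
... | no p⊈⁅x⁆ with ⊈⇒∃ p⊈⁅x⁆
...   | y , y∈p , y∉⁅x⁆ = y , y∈p , x∉⁅y⁆⇒x≢y y∉⁅x⁆

∣p∣≡n⇒∣∁p∣≡1 : ∀ {n} (p : Subset (suc n)) → ∣ p ∣ ≡ n → ∣ ∁ p ∣ ≡ 1
∣p∣≡n⇒∣∁p∣≡1 {n} p ∣p∣≡n = trans (∣∁p∣≡n∸∣p∣ p) (trans (cong (suc n ℕ.∸_) ∣p∣≡n) (ℕ.m+n∸n≡m 1 n))

∣p∣≡n⇒∁p-singleton : ∀ {n} (p : Subset (suc n)) → ∣ p ∣ ≡ n →
                      ∃ λ a → a ∉ p × (∀ {x} → x ≢ a → x ∈ p)
∣p∣≡n⇒∁p-singleton p ∣p∣≡n with 1≤∣p∣⇒∃∈ {p = ∁ p} (ℕ.≤-reflexive (sym (∣p∣≡n⇒∣∁p∣≡1 p ∣p∣≡n)))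
... | a , a∈∁p = a , x∈∁p⇒x∉p a∈∁p , λ {x} x≢a → unique x x≢a
  where
  unique : ∀ x → x ≢ a → x ∈ p
  unique x x≢a with x ∈? p
  ... | yes x∈p = x∈p
  ... | no x∉p = ⊥-elim (ℕ.<⇒≱ (distinct⇒2≤∣p∣ (x∉p⇒x∈∁p x∉p) a∈∁p x≢a)
                                (ℕ.≤-reflexive (∣p∣≡n⇒∣∁p∣≡1 p ∣p∣≡n)))

record PairAndCopoint {n} (Sp Sq : Subset (suc n)) : Set where
  field
    a b   : Fin (suc n)
    b≢a   : b ≢ a
    a∈Sp  : a ∈ Sp
    b∈Sp  : b ∈ Sp
    ∉Sp   : ∀ {x} → x ≢ a → x ≢ b → x ∉ Sp
    a∉Sq  : a ∉ Sq
    ∈Sq   : ∀ {x} → x ≢ a → x ∈ Sq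

pairAndCopoint : ∀ {n} {Sp Sq : Subset (suc n)} →
                 ∣ Sp ∩ Sq ∣ ≡ 1 → ∣ Sp ∣ ≡ 2 → ∣ Sq ∣ ≡ n → PairAndCopoint Sp Sq
pairAndCopoint {Sp = Sp} {Sq} ∣Sp∩Sq∣≡1 ∣Sp∣≡2 ∣Sq∣≡n with ∣p∣≡n⇒∁p-singleton Sq ∣Sq∣≡n
... | a , a∉Sq , ∈Sq with 2≤∣p∣⇒∃∈≢ (ℕ.≤-reflexive (sym ∣Sp∣≡2)) a
...   | b , b∈Sp , b≢a = record
  { a = a ; b = b ; b≢a = b≢a ; a∈Sp = a∈Sp ; b∈Sp = b∈Sp
  ; ∉Sp = λ x≢a x≢b x∈Sp → apart x∈Sp b∈Sp x≢b x≢a b≢a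
  ; a∉Sq = a∉Sq ; ∈Sq = ∈Sq }
  where
  2≤∣Sp∣ : 2 ℕ.≤ ∣ Sp ∣
  2≤∣Sp∣ = ℕ.≤-reflexive (sym ∣Sp∣≡2)
  apart : ∀ {x y} → x ∈ Sp → y ∈ Sp → x ≢ y → x ≢ a → y ≢ a → ⊥
  apart x∈Sp y∈Sp x≢y x≢a y≢a =
    ℕ.<⇒≱ (distinct⇒2≤∣p∣ (x∈p∩q⁺ (x∈Sp , ∈Sq x≢a)) (x∈p∩q⁺ (y∈Sp , ∈Sq y≢a)) x≢y) (ℕ.≤-reflexive ∣Sp∩Sq∣≡1)
  a∈Sp : a ∈ Sp
  a∈Sp with a ∈? Sp | 2≤∣p∣⇒∃∈≢ 2≤∣Sp∣ b
  ... | yes a∈Sp | _ = a∈Sp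
  ... | no a∉Sp | c , c∈Sp , c≢b =
    ⊥-elim (apart b∈Sp c∈Sp (c≢b ∘ sym) (∈∧∉⇒≢ b∈Sp a∉Sp) (∈∧∉⇒≢ c∈Sp a∉Sp))

module Simplex (R : RealField) {n} (e : Fin (suc n) → Geometry.Vec R n) where
  open RealField R
  open Geometry R
  open OrderedField R
  open Sums R
  open Coordinates R

  -- With D = P − Q and N = n + 1, the vector N D − Σ D has coefficient sum 0 and represents 0,
  -- so it vanishes by affine independence; hence D is constant.
  lincomb-injective : AffinelyIndependent e → lincomb (λ _ → 1r) e ≐ 0v →
                      ∀ {P Q} → lincomb P e ≐ lincomb Q e → P ≃ Q
  lincomb-injective aff Σe≡0 {P} {Q} LP≐LQ k l = x+-y≡z+-w⇒x+w≡z+y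
    (*-cancelˡ-pos (0<sumF1 {n}) (+-cancelʳ (- s) (N * D k) (N * D l) (trans (λ′≡0 k) (sym (λ′≡0 l)))))
    where
    D : Fin (suc n) → ℝ
    D t = P t + - Q t
    N s : ℝ
    N = sumF {suc n} (λ _ → 1r)
    s = sumF D
    λ′ : Fin (suc n) → ℝ
    λ′ t = N * D t + - s
    LD≐0 : lincomb D e ≐ 0v
    LD≐0 j = trans (lincomb-+ P (λ t → - Q t) e j)
      (trans (cong (lincomb P e j +_) (lincomb-neg Q e j))
        (trans (cong (λ z → z + - lincomb Q e j) (LP≐LQ j)) (+-invʳ (lincomb Q e j))))
    Lλ′≐0 : lincomb λ′ e ≐ 0v
    Lλ′≐0 j = trans (lincomb-+ (λ t → N * D t) (λ _ → - s) e j)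
      (trans (cong₂ _+_ (trans (lincomb-*ˡ N D e j) (cong (N *_) (LD≐0 j)))
                        (trans (lincomb-const (- s) e j) (cong (- s *_) (Σe≡0 j))))
        (trans (cong₂ _+_ (zeroʳ N) (zeroʳ (- s))) (+-idʳ 0r)))
    Σλ′≡0 : sumF λ′ ≡ 0r
    Σλ′≡0 = trans (sumF-+ (λ t → N * D t) (λ _ → - s))
      (trans (cong₂ _+_ (sumF-*ˡ N D) (sumF-const {suc n} (- s)))
        (trans (cong (N * s +_) (trans (sym (-‿distribˡ-* s N)) (cong -_ (*-comm s N)))) (+-invʳ (N * s))))
    λ′≡0 : ∀ t → λ′ t ≡ 0r
    λ′≡0 = aff λ′ Σλ′≡0 Lλ′≐0

  conicalPosition : AffinelyIndependent e → lincomb (λ _ → 1r) e ≐ 0v →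
                    ∀ {K} {y : Fin K → Vec n} (Λ : Fin K → Fin (suc n) → ℝ) →
                    (∀ l → y l ≐ lincomb (Λ l) e) → ConicalCoordinates Λ → ConicalPosition y
  conicalPosition aff Σe≡0 {K} {y} Λ y≐Λe (no-convex , no-positive) = zero-outside , no-point-inside
    where
    zero-outside : ¬ Σ (Fin K → ℝ) λ ν → NonNeg ν × (sumF ν ≡ 1r) × (lincomb ν y ≐ 0v)
    zero-outside (ν , ν≥0 , Σν≡1 , νy≐0) = no-convex ν ν≥0 Σν≡1 λ k l →
      trans (sym (+-idʳ _)) (trans (lincomb-injective aff Σe≡0 Lν≐L0 k l) (+-idʳ _))
      where
      Lν≐L0 : lincomb (combination Λ ν) e ≐ lincomb (λ _ → 0r) e
      Lν≐L0 j = trans (sym (lincomb-combination e Λ y y≐Λe ν j)) (trans (νy≐0 j) (sym (lincomb-zero e j)))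
    no-point-inside : ∀ t → ¬ Σ (Fin K → ℝ) λ ν → NonNeg ν × (ν t ≡ 0r) × (y t ≐ lincomb ν y)
    no-point-inside t (ν , ν≥0 , νt≡0 , yt≐νy) =
      no-positive t ν ν≥0 νt≡0 (lincomb-injective aff Σe≡0 Lν≐LΛt)
      where
      Lν≐LΛt : lincomb (combination Λ ν) e ≐ lincomb (Λ t) e
      Lν≐LΛt j = trans (sym (lincomb-combination e Λ y y≐Λe ν j)) (trans (sym (yt≐νy j)) (y≐Λe t j))

  record Coefficients (y : Vec n) (S : Subset (suc n)) : Set where
    field
      coeff      : Fin (suc n) → ℝ
      represents : y ≐ lincomb coeff e
      positive   : ∀ {k} → k ∈ S → 0r < coeff k
      vanishes   : ∀ {k} → k ∉ S → coeff k ≡ 0r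

    ∉<∈ : ∀ {k l} → k ∉ S → l ∈ S → coeff k < coeff l
    ∉<∈ k∉S l∈S = subst (_< coeff _) (sym (vanishes k∉S)) (positive l∈S)

    ∉≤∉ : ∀ {k l} → k ∉ S → l ∉ S → coeff k ≤ coeff l
    ∉≤∉ k∉S l∉S = inj₂ (trans (vanishes k∉S) (sym (vanishes l∉S)))

  support⇒coefficients : ∀ {y S} → IsSupport e y S → Coefficients y S
  support⇒coefficients {S = S} ((λs , λs≥0 , λs-vanishes , y≐λe) , minimal) = record
    { coeff = λs ; represents = y≐λe ; positive = positive ; vanishes = λ {k} → λs-vanishes k }
    where
    positive : ∀ {k} → k ∈ S → 0r < λs k
    positive {k} k∈S with λs≥0 k
    ... | inj₁ 0<λk = 0<λk
    ... | inj₂ 0≡λk = ⊥-elim (minimal (S ∖ k) (x∈p⇒p-x⊂p k∈S) (λs , λs≥0 , vanishes-off , y≐λe))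
      where
      vanishes-off : ∀ l → l ∉ S ∖ k → λs l ≡ 0r
      vanishes-off l l∉S-k with l ≟ k
      ... | yes refl = sym 0≡λk
      ... | no l≢k = λs-vanishes l (λ l∈S → l∉S-k (x∈p∧x≢y⇒x∈p-y l∈S l≢k))

  argmin : ∀ {k} (f : Fin (suc k) → ℝ) → Σ (Fin (suc k)) λ i → ∀ l → f i ≤ f l
  argmin {ℕ.zero} f = zero , λ { zero → ≤-refl }
  argmin {suc _} f with argmin (f ∘ suc)
  ... | i , min with <⊎≥ (f (suc i)) (f zero)
  ...   | inj₁ f[1+i]<f0 = suc i , λ { zero → inj₁ f[1+i]<f0 ; (suc l) → min l }
  ...   | inj₂ f0≤f[1+i] = zero , λ { zero → ≤-refl ; (suc l) → ≤-trans f0≤f[1+i] (min l) }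

  -- A support containing every vertex is not minimal: since Σ e = 0, subtracting the least
  -- coefficient from all of them still represents y.
  support-not-full : lincomb (λ _ → 1r) e ≐ 0v → ∀ {y S} → IsSupport e y S → ∃ λ c → c ∉ S
  support-not-full Σe≡0 {y} {S} ((λs , λs≥0 , λs-vanishes , y≐λe) , minimal) with ⊤ ⊆? S
  ... | no ⊤⊈S = let c , _ , c∉S = ⊈⇒∃ ⊤⊈S in c , c∉S
  ... | yes ⊤⊆S = ⊥-elim (minimal (S ∖ i) (x∈p⇒p-x⊂p (⊤⊆S ∈⊤)) (λ′ , λ′≥0 , λ′-vanishes , y≐λ′e))
    where
    i : Fin (suc n)
    i = proj₁ (argmin λs)
    λ′ : Fin (suc n) → ℝ
    λ′ l = λs l + - λs i
    λ′≥0 : ∀ l → 0r ≤ λ′ l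
    λ′≥0 l = ≤⇒0≤y-x (proj₂ (argmin λs) l)
    λ′-vanishes : ∀ l → l ∉ S ∖ i → λ′ l ≡ 0r
    λ′-vanishes l l∉S-i with l ≟ i
    ... | yes refl = +-invʳ (λs i)
    ... | no l≢i = ⊥-elim (l∉S-i (x∈p∧x≢y⇒x∈p-y (⊤⊆S ∈⊤) l≢i))
    y≐λ′e : y ≐ lincomb λ′ e
    y≐λ′e j = begin
      y j                                               ≡⟨ y≐λe j ⟩
      lincomb λs e j                                    ≡⟨ +-idʳ _ ⟨
      lincomb λs e j + 0r                               ≡⟨ cong (lincomb λs e j +_) (zeroʳ (- λs i)) ⟨
      lincomb λs e j + - λs i * 0r                      ≡⟨ cong (λ z → lincomb λs e j + - λs i * z) (Σe≡0 j) ⟨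
      lincomb λs e j + - λs i * lincomb (λ _ → 1r) e j  ≡⟨ cong (lincomb λs e j +_) (lincomb-const (- λs i) e j) ⟨
      lincomb λs e j + lincomb (λ _ → - λs i) e j       ≡⟨ lincomb-+ λs (λ _ → - λs i) e j ⟨
      lincomb λ′ e j                                    ∎
      where
      open ≡-Reasoning

  module PointSet (aff : AffinelyIndependent e) (Σe≡0 : lincomb (λ _ → 1r) e ≐ 0v)
                  {m} (x : Fin m → Vec n) (idx : Fin (suc n) → Fin m) (x∘idx≐e : ∀ k → x (idx k) ≐ e k)
                  (noCP : ∀ (f : Fin (suc n) → Fin m) → (∀ a b → f a ≡ f b → a ≡ b) →
                          ¬ ConicalPosition (λ a → x (f a))) where
    open Coefficients

    x∘idx≐δe : ∀ k → x (idx k) ≐ lincomb (δ k) e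
    x∘idx≐δe k j = trans (x∘idx≐e k j) (sym (lincomb-δ e k j))

    ¬conical-substitution : ∀ {i j U V} u v → x u ≐ lincomb U e → x v ≐ lincomb V e →
                            ¬ ConicalCoordinates (substitute i j U V δ)
    ¬conical-substitution {i} {j} {U} {V} u v xu≐Ue xv≐Ve conical = noCP f f-injective x∘f-conical
      where
      f : Fin (suc n) → Fin m
      f = substitute i j u v idx
      x∘f≐Λe : ∀ l → x (f l) ≐ lincomb (substitute i j U V δ l) e
      x∘f≐Λe = substitute-preserves (λ w row → x w ≐ lincomb row e) i j xu≐Ue xv≐Ve x∘idx≐δe
      x∘f-conical : ConicalPosition (λ a → x (f a))
      x∘f-conical = conicalPosition aff Σe≡0 (substitute i j U V δ) x∘f≐Λe conical
      f-injective : ∀ a b → f a ≡ f b → a ≡ b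
      f-injective a b fa≡fb = conicalPosition⇒injective x∘f-conical (λ k → cong (λ w → x w k) fa≡fb)

    supports-cannot-cross : ∀ {p r Sp Sr u w c d} → Coefficients (x p) Sp → Coefficients (x r) Sr →
                            u ∈ Sp → u ∈ Sr → w ∈ Sp → w ∉ Sr → d ∉ Sp → d ∈ Sr → c ∉ Sp → c ∉ Sr → ⊥
    supports-cannot-cross {p} {r} Cp Cr u∈Sp u∈Sr w∈Sp w∉Sr d∉Sp d∈Sr c∉Sp c∉Sr =
      ¬conical-substitution p r (represents Cp) (represents Cr)
        (conical-agreeing (∉<∈ Cp c∉Sp u∈Sp) (∉<∈ Cr c∉Sr u∈Sr) (∉≤∉ Cp d∉Sp c∉Sp) (∉<∈ Cr c∉Sr d∈Sr)
                          (∉≤∉ Cr w∉Sr c∉Sr) (∉<∈ Cp c∉Sp w∈Sp))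
      where
      open Substitution _ _ (∈∧∉⇒≢ u∈Sp c∉Sp ∘ sym) (coeff Cp) (coeff Cr)

    -- Compare the coefficients σ of q at b, c and d. If σ b is the least, replacing e_b by q alone
    -- gives a family in conical position; otherwise replace e_a by q and e_m by p or r, where m is
    -- whichever of c, d has the smaller σ-coefficient.
    supports-cannot-nest : ∀ {p q r Sp Sq Sr a b c d} →
                           Coefficients (x q) Sq → Coefficients (x p) Sp → Coefficients (x r) Sr →
                           a ∉ Sq → b ∈ Sq → c ∈ Sq → d ∈ Sq → a ∈ Sp → b ∈ Sp → c ∉ Sp → d ∉ Sp →
                           a ∈ Sr → b ∈ Sr → c ∉ Sr → d ∈ Sr → ⊥
    supports-cannot-nest {p} {q} {r} {a = a} {b} {c} {d} Cq Cp Cr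
                         a∉Sq b∈Sq c∈Sq d∈Sq a∈Sp b∈Sp c∉Sp d∉Sp a∈Sr b∈Sr c∉Sr d∈Sr =
      by-comparison (<⊎≥ (σ d) (σ c)) (<⊎≥ (σ b) (σ d)) (<⊎≥ (σ b) (σ c))
      where
      σ : Fin (suc n) → ℝ
      σ = coeff Cq

      below-both : σ b < σ c → σ b < σ d → ⊥
      below-both σb<σc σb<σd = ¬conical-substitution (idx a) q (x∘idx≐δe a) (represents Cq)
        (conical-single (∈∧∉⇒≢ d∈Sr c∉Sr ∘ sym) (∉<∈ Cq a∉Sq b∈Sq) σb<σc σb<σd)

      by-comparison : (σ d < σ c) ⊎ (σ c ≤ σ d) → (σ b < σ d) ⊎ (σ d ≤ σ b) → (σ b < σ c) ⊎ (σ c ≤ σ b) → ⊥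
      by-comparison (inj₁ σd<σc) (inj₁ σb<σd) _ = below-both (<-trans σb<σd σd<σc) σb<σd
      by-comparison (inj₁ σd<σc) (inj₂ σd≤σb) _ =
        ¬conical-substitution q p (represents Cq) (represents Cp)
          (conical-opposed (∈∧∉⇒≢ b∈Sp c∉Sp) (∉<∈ Cq a∉Sq d∈Sq) (∉<∈ Cp d∉Sp a∈Sp)
                           (σd≤σb , inj₁ (∉<∈ Cp d∉Sp b∈Sp) , inj₂ (∉<∈ Cp d∉Sp b∈Sp))
                           (inj₁ σd<σc , ∉≤∉ Cp d∉Sp c∉Sp , inj₁ σd<σc))
        where
        open Substitution a d (∈∧∉⇒≢ d∈Sq a∉Sq) (coeff Cq) (coeff Cp)
      by-comparison (inj₂ σc≤σd) _ (inj₁ σb<σc) = below-both σb<σc (<-≤-trans σb<σc σc≤σd)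
      by-comparison (inj₂ σc≤σd) _ (inj₂ σc≤σb) =
        ¬conical-substitution q r (represents Cq) (represents Cr)
          (conical-opposed (∈∧∉⇒≢ b∈Sp d∉Sp) (∉<∈ Cq a∉Sq c∈Sq) (∉<∈ Cr c∉Sr a∈Sr)
                           (σc≤σb , inj₁ (∉<∈ Cr c∉Sr b∈Sr) , inj₂ (∉<∈ Cr c∉Sr b∈Sr))
                           (σc≤σd , inj₁ (∉<∈ Cr c∉Sr d∈Sr) , inj₂ (∉<∈ Cr c∉Sr d∈Sr)))
        where
        open Substitution a c (∈∧∉⇒≢ c∈Sq a∉Sq) (coeff Cq) (coeff Cr)

    module Cases {p q r : Fin m} {Sp Sq Sr : Subset (suc n)}
                 (Cp : Coefficients (x p) Sp) (Cq : Coefficients (x q) Sq) (Cr : Coefficients (x r) Sr)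
                 (Sr-not-full : ∃ λ c → c ∉ Sr) (shape : PairAndCopoint Sp Sq)
                 (Sr≢Sp : Sr ≢ Sp) (Sr≢Sq : Sr ≢ Sq) (2≤∣Sr∣ : 2 ℕ.≤ ∣ Sr ∣) where
      open PairAndCopoint shape public

      neither : a ∉ Sr → b ∉ Sr → Sr ⊆ Sq ─ Sp
      neither a∉Sr b∉Sr k∈Sr =
        x∈p∧x∉q⇒x∈p─q (∈Sq (∈∧∉⇒≢ k∈Sr a∉Sr)) (∉Sp (∈∧∉⇒≢ k∈Sr a∉Sr) (∈∧∉⇒≢ k∈Sr b∉Sr))

      only-b : a ∉ Sr → b ∈ Sr → ⊥
      only-b a∉Sr b∈Sr with Sq ⊆? Sr | 2≤∣p∣⇒∃∈≢ 2≤∣Sr∣ b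
      ... | yes Sq⊆Sr | _ = Sr≢Sq (⊆-antisym (λ k∈Sr → ∈Sq (∈∧∉⇒≢ k∈Sr a∉Sr)) Sq⊆Sr)
      ... | no Sq⊈Sr | d , d∈Sr , d≢b with ⊈⇒∃ Sq⊈Sr
      ...   | c , c∈Sq , c∉Sr = supports-cannot-cross Cp Cr b∈Sp b∈Sr a∈Sp a∉Sr
        (∉Sp (∈∧∉⇒≢ d∈Sr a∉Sr) d≢b) d∈Sr (∉Sp (∈∧∉⇒≢ c∈Sq a∉Sq) (∈∧∉⇒≢ b∈Sr c∉Sr ∘ sym)) c∉Sr

      only-a : a ∈ Sr → b ∉ Sr → Sr ≡ (Sp ─ Sq) ∪ (Sq ─ Sp)
      only-a a∈Sr b∉Sr with (Sp ─ Sq) ∪ (Sq ─ Sp) ⊆? Sr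
      ... | yes T⊆Sr = ⊆-antisym Sr⊆T T⊆Sr
        where
        Sr⊆T : Sr ⊆ (Sp ─ Sq) ∪ (Sq ─ Sp)
        Sr⊆T {k} k∈Sr with k ≟ a
        ... | yes refl = x∈p∪q⁺ (inj₁ (x∈p∧x∉q⇒x∈p─q a∈Sp a∉Sq))
        ... | no k≢a = x∈p∪q⁺ (inj₂ (x∈p∧x∉q⇒x∈p─q (∈Sq k≢a) (∉Sp k≢a (∈∧∉⇒≢ k∈Sr b∉Sr))))
      ... | no T⊈Sr with ⊈⇒∃ T⊈Sr | 2≤∣p∣⇒∃∈≢ 2≤∣Sr∣ a
      ...   | c , c∈T , c∉Sr | d , d∈Sr , d≢a = ⊥-elim (supports-cannot-cross Cp Cr a∈Sp a∈Sr b∈Sp b∉Sr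
        (∉Sp d≢a (∈∧∉⇒≢ d∈Sr b∉Sr)) d∈Sr (∉Sp (∈∧∉⇒≢ a∈Sr c∉Sr ∘ sym) c≢b) c∉Sr)
        where
        c≢b : c ≢ b
        c≢b refl with x∈p∪q⁻ (Sp ─ Sq) (Sq ─ Sp) c∈T
        ... | inj₁ c∈Sp─Sq = x∈p─q⇒x∉q c∈Sp─Sq (∈Sq b≢a)
        ... | inj₂ c∈Sq─Sp = x∈p─q⇒x∉q c∈Sq─Sp b∈Sp

      both : a ∈ Sr → b ∈ Sr → ⊥
      both a∈Sr b∈Sr with Sr ⊆? Sp
      ... | yes Sr⊆Sp = Sr≢Sp (⊆-antisym Sr⊆Sp Sp⊆Sr)
        where
        Sp⊆Sr : Sp ⊆ Sr
        Sp⊆Sr {k} k∈Sp with k ≟ a | k ≟ b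
        ... | yes refl | _ = a∈Sr
        ... | no _ | yes refl = b∈Sr
        ... | no k≢a | no k≢b = ⊥-elim (∉Sp k≢a k≢b k∈Sp)
      ... | no Sr⊈Sp with ⊈⇒∃ Sr⊈Sp
      ...   | d , d∈Sr , d∉Sp = supports-cannot-nest Cq Cp Cr a∉Sq (∈Sq b≢a) (∈Sq c≢a) (∈Sq d≢a)
        a∈Sp b∈Sp (∉Sp c≢a (∈∧∉⇒≢ b∈Sr c∉Sr ∘ sym)) d∉Sp a∈Sr b∈Sr c∉Sr d∈Sr
        where
        c : Fin (suc n)
        c = proj₁ Sr-not-full
        c∉Sr : c ∉ Sr
        c∉Sr = proj₂ Sr-not-full
        c≢a : c ≢ a
        c≢a = ∈∧∉⇒≢ a∈Sr c∉Sr ∘ sym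
        d≢a : d ≢ a
        d≢a = ∈∧∉⇒≢ a∈Sp d∉Sp ∘ sym

proposition17 :
    (R : RealField) → let open RealField R in let open Geometry R in
    (n : ℕ) (e : Fin (suc n) → Vec n) →
    AffinelyIndependent e →
    lincomb (λ _ → 1r) e ≐ 0v →
    (m : ℕ) (x : Fin m → Vec n) →
    (∀ i j → x i ≐ x j → i ≡ j) →
    (∀ i → ¬ (x i ≐ 0v)) →
    (∀ k → Σ (Fin m) (λ i → x i ≐ e k)) →
    (∀ i j → i ≢ j → ¬ Σ ℝ (λ c → (0r < c) × (x i ≐ (c · x j)))) →
    (∀ (f : Fin (suc n) → Fin m) → (∀ a b → f a ≡ f b → a ≡ b) →
       ¬ ConicalPosition (λ a → x (f a))) →
    (p q r : Fin m) (Sp Sq Sr : Subset (suc n)) →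
    IsSupport e (x p) Sp → IsSupport e (x q) Sq → IsSupport e (x r) Sr →
    ∣ Sp ∩ Sq ∣ ≡ 1 → ∣ Sp ∣ ≡ 2 → ∣ Sq ∣ ≡ n →
    Sr ≢ Sp → Sr ≢ Sq → 2 Data.Nat.≤ ∣ Sr ∣ →
    (Sr ⊆ (Sq ─ Sp)) ⊎ (Sr ≡ ((Sp ─ Sq) ∪ (Sq ─ Sp)))
proposition17 R n e aff Σe≡0 m x _ _ E⊆X _ noCP p q r Sp Sq Sr Sp-support Sq-support Sr-support
              ∣Sp∩Sq∣≡1 ∣Sp∣≡2 ∣Sq∣≡n Sr≢Sp Sr≢Sq 2≤∣Sr∣ = by-cases (a ∈? Sr) (b ∈? Sr)
  where
  open Simplex R e
  open PointSet aff Σe≡0 x (λ k → proj₁ (E⊆X k)) (λ k → proj₂ (E⊆X k)) noCP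
  open Cases (support⇒coefficients Sp-support) (support⇒coefficients Sq-support)
             (support⇒coefficients Sr-support) (support-not-full Σe≡0 Sr-support)
             (pairAndCopoint ∣Sp∩Sq∣≡1 ∣Sp∣≡2 ∣Sq∣≡n) Sr≢Sp Sr≢Sq 2≤∣Sr∣

  by-cases : Dec (a ∈ Sr) → Dec (b ∈ Sr) → (Sr ⊆ (Sq ─ Sp)) ⊎ (Sr ≡ ((Sp ─ Sq) ∪ (Sq ─ Sp)))
  by-cases (no a∉Sr) (no b∉Sr) = inj₁ (neither a∉Sr b∉Sr)
  by-cases (no a∉Sr) (yes b∈Sr) = ⊥-elim (only-b a∉Sr b∈Sr)
  by-cases (yes a∈Sr) (no b∉Sr) = inj₂ (only-a a∈Sr b∉Sr)
  by-cases (yes a∈Sr) (yes b∈Sr) = ⊥-elim (both a∈Sr b∈Sr)
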